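{- A finite bounded hoop $\mathbf A$ is finitely projective in the variety of bounded hoops if and only if there exists a homomorphism $\varphi:\mathbf A\to\mathbf 2$, where $\mathbf 2$ is the two-element bounded hoop $\{0,1\}$.
   Context: A hoop is an algebra $\langle A,\cdot,\rightarrow,1\rangle$ with $\langle A,\cdot,1\rangle$ a commutative monoid satisfying $x\rightarrow x\approx 1$, $x(x\rightarrow y)\approx y(y\rightarrow x)$, $(xy)\rightarrow z\approx x\rightarrow(y\rightarrow z)$; a bounded hoop additionally has a constant $0$ that is the least element. An algebra $\mathbf A$ in a class $\mathcal K$ is projective in $\mathcal K$ if for all $\mathbf B,\mathbf C\in\mathcal K$, every homomorphism $h:\mathbf A\to\mathbf C$ and every surjective homomorphism $g:\mathbf B\to\mathbf C$ there is a homomorphism $f:\mathbf A\to\mathbf B$ with $h=gf$. A finite algebra is finitely projective in a variety $\mathcal V$ if it is projective in the class of finite members of $\mathcal V$. -}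

module Defs where

open import Level using (Level; suc; _⊔_)
open import Data.Nat using (ℕ)
open import Data.Fin using (Fin)
open import Data.Bool using (Bool; true; false; _∧_)
open import Data.Product using (Σ; ∃; _,_)
open import Function.Bundles using (_↔_)
open import Relation.Binary.PropositionalEquality using (_≡_; refl)

record BoundedHoop : Set₁ where
  infixl 7 _·_
  infixr 5 _⇒_
  field
    Carrier : Set
    _·_     : Carrier → Carrier → Carrier
    _⇒_     : Carrier → Carrier → Carrier
    𝟏       : Carrier
    𝟎       : Carrier
    ·-assoc   : ∀ x y z → (x · y) · z ≡ x · (y · z)
    ·-comm    : ∀ x y → x · y ≡ y · x
    ·-identityˡ : ∀ x → 𝟏 · x ≡ x
    ⇒-refl    : ∀ x → x ⇒ x ≡ 𝟏
    divisibility : ∀ x y → x · (x ⇒ y) ≡ y · (y ⇒ x)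
    residuation  : ∀ x y z → (x · y) ⇒ z ≡ x ⇒ (y ⇒ z)
    -- 0 is the least element w.r.t. the hoop order (x ≤ y iff x ⇒ y = 1)
    𝟎-least   : ∀ x → 𝟎 ⇒ x ≡ 𝟏

open BoundedHoop public

record IsHom (A B : BoundedHoop) (f : Carrier A → Carrier B) : Set where
  field
    pres-·  : ∀ x y → f (_·_ A x y) ≡ _·_ B (f x) (f y)
    pres-⇒  : ∀ x y → f (_⇒_ A x y) ≡ _⇒_ B (f x) (f y)
    pres-𝟏  : f (𝟏 A) ≡ 𝟏 B
    pres-𝟎  : f (𝟎 A) ≡ 𝟎 B

Hom : BoundedHoop → BoundedHoop → Set
Hom A B = Σ (Carrier A → Carrier B) (IsHom A B)

Surjective : {X Y : Set} → (X → Y) → Set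
Surjective {X} {Y} g = ∀ (y : Y) → ∃ λ (x : X) → g x ≡ y

Finite : BoundedHoop → Set
Finite A = ∃ λ (n : ℕ) → Carrier A ↔ Fin n

FinitelyProjective : BoundedHoop → Set₁
FinitelyProjective A =
  ∀ (B C : BoundedHoop) → Finite B → Finite C →
  ∀ (h : Hom A C) (g : Hom B C) → Surjective (Data.Product.proj₁ g) →
  ∃ λ (f : Hom A B) →
    ∀ x → Data.Product.proj₁ h x ≡ Data.Product.proj₁ g (Data.Product.proj₁ f x)

_⇒𝟚_ : Bool → Bool → Bool
true  ⇒𝟚 y = y
false ⇒𝟚 y = true

𝟚 : BoundedHoop
𝟚 = record
  { Carrier = Bool ; _·_ = _∧_ ; _⇒_ = _⇒𝟚_ ; 𝟏 = true ; 𝟎 = false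
  ; ·-assoc = λ { true y z → refl ; false y z → refl }
  ; ·-comm = λ { true true → refl ; true false → refl ; false true → refl ; false false → refl }
  ; ·-identityˡ = λ x → refl
  ; ⇒-refl = λ { true → refl ; false → refl }
  ; divisibility = λ { true true → refl ; true false → refl ; false true → refl ; false false → refl }
  ; residuation = λ { true y z → refl ; false y z → refl }
  ; 𝟎-least = λ x → refl
  }

-- (⇒) Lift A → 𝟙 along the surjection 𝟚 → 𝟙.
-- (⇐) Let g : B → C be a surjection of finite bounded hoops and h : A → C. The filter
-- g⁻¹(1) has a least element u, which is idempotent, and x ↦ u ⇒ x is a retraction of B
-- onto its u-fixed elements that preserves · and ⇒ and whose value at x depends only on
-- g x. Hence ρ c = u ⇒ (any preimage of c) is a section of g preserving ·, ⇒ and 𝟏, but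
-- it sends 𝟎 to ¬ u. The homomorphism φ : A → 𝟚 repairs this: multiplying by the
-- idempotent ¬ ¬ u, which g sends to 𝟏, exactly where φ is 0 gives a homomorphism f with
-- g ∘ f = h.
module Submission where

open import Algebra.Bundles using (CommutativeSemigroup)
import Algebra.Properties.CommutativeSemigroup as CommutativeSemigroupProperties
open import Data.Bool using (Bool; true; false; _∧_)
open import Data.Fin using (Fin; zero; suc)
open import Data.Fin.Properties using (inj⇒≟)
open import Data.Nat using (zero; suc)
open import Data.Product using (Σ; _×_; _,_; proj₁; proj₂)
open import Data.Unit using (⊤; tt)
open import Function using (_∘_)
open import Function.Bundles using (_⇔_; mk⇔; Inverse; mk↔ₛ′)
open import Function.Properties.Inverse using (↔⇒↣)
open import Relation.Binary using (Poset; DecidableEquality)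
open import Relation.Binary.PropositionalEquality
open import Relation.Nullary using (yes; no; contradiction)
import Relation.Binary.Reasoning.PartialOrder as PartialOrderReasoning
open import Relation.Unary using (Pred; Decidable)

open import Defs
  using (BoundedHoop; IsHom; Hom; Surjective; Finite; FinitelyProjective; 𝟚; _⇒𝟚_)

module HoopProperties (H : BoundedHoop) where
  open BoundedHoop H

  ·-commutativeSemigroup : CommutativeSemigroup _ _
  ·-commutativeSemigroup = record
    { isCommutativeSemigroup = record
      { isSemigroup = record
        { isMagma = record { isEquivalence = isEquivalence ; ∙-cong = cong₂ _·_ }
        ; assoc = ·-assoc }
      ; comm = ·-comm } }

  open CommutativeSemigroupProperties ·-commutativeSemigroup public
    using (interchange; xy∙z≈xz∙y)

  ·-identityʳ : ∀ x → x · 𝟏 ≡ x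
  ·-identityʳ x = trans (·-comm x 𝟏) (·-identityˡ x)

  infix 4 _≤_
  _≤_ : Carrier → Carrier → Set
  x ≤ y = x ⇒ y ≡ 𝟏

  infixl 6 _⊓_
  _⊓_ : Carrier → Carrier → Carrier
  x ⊓ y = x · (x ⇒ y)

  ≤-refl : ∀ {x} → x ≤ x
  ≤-refl {x} = ⇒-refl x

  ≤-reflexive : ∀ {x y} → x ≡ y → x ≤ y
  ≤-reflexive refl = ≤-refl

  curry-≤ : ∀ {x y z} → x · y ≤ z → x ≤ y ⇒ z
  curry-≤ {x} {y} {z} = trans (sym (residuation x y z))

  uncurry-≤ : ∀ {x y z} → x ≤ y ⇒ z → x · y ≤ z
  uncurry-≤ {x} {y} {z} = trans (residuation x y z)

  x≤y⇒x≡y⊓x : ∀ {x y} → x ≤ y → x ≡ y ⊓ x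
  x≤y⇒x≡y⊓x {x} {y} x≤y = begin
    x             ≡⟨ sym (·-identityʳ x) ⟩
    x · 𝟏         ≡⟨ cong (x ·_) x≤y ⟨
    x · (x ⇒ y)   ≡⟨ divisibility x y ⟩
    y · (y ⇒ x)   ∎
    where open ≡-Reasoning

  ≤-antisym : ∀ {x y} → x ≤ y → y ≤ x → x ≡ y
  ≤-antisym {x} {y} x≤y y≤x = begin
    x             ≡⟨ x≤y⇒x≡y⊓x x≤y ⟩
    y · (y ⇒ x)   ≡⟨ cong (y ·_) y≤x ⟩
    y · 𝟏         ≡⟨ ·-identityʳ y ⟩
    y             ∎
    where open ≡-Reasoning

  ⇒-identityˡ : ∀ x → 𝟏 ⇒ x ≡ x
  ⇒-identityˡ x = ≤-antisym
    (trans (cong (_⇒ x) (sym (·-identityʳ (𝟏 ⇒ x)))) (uncurry-≤ ≤-refl))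
    (curry-≤ (trans (cong (_⇒ x) (·-identityʳ x)) ≤-refl))

  ⇒-zeroʳ : ∀ x → x ⇒ 𝟏 ≡ 𝟏
  ⇒-zeroʳ x = begin
    t             ≡⟨ cong (_⇒ 𝟏) x·t≡x ⟨
    (x · t) ⇒ 𝟏   ≡⟨ cong (_⇒ 𝟏) (·-comm x t) ⟩
    (t · x) ⇒ 𝟏   ≡⟨ residuation t x 𝟏 ⟩
    t ⇒ t         ≡⟨ ⇒-refl t ⟩
    𝟏             ∎
    where
    open ≡-Reasoning
    t = x ⇒ 𝟏
    x·t≡x : x · t ≡ x
    x·t≡x = trans (divisibility x 𝟏) (trans (·-identityˡ _) (⇒-identityˡ x))

  ≤-trans : ∀ {x y z} → x ≤ y → y ≤ z → x ≤ z
  ≤-trans {x} {y} {z} x≤y y≤z = begin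
    x ⇒ z                 ≡⟨ cong (_⇒ z) (trans (x≤y⇒x≡y⊓x x≤y) (·-comm y _)) ⟩
    ((y ⇒ x) · y) ⇒ z     ≡⟨ residuation _ y z ⟩
    (y ⇒ x) ⇒ (y ⇒ z)     ≡⟨ cong ((y ⇒ x) ⇒_) y≤z ⟩
    (y ⇒ x) ⇒ 𝟏           ≡⟨ ⇒-zeroʳ _ ⟩
    𝟏                     ∎
    where open ≡-Reasoning

  ≤-poset : Poset _ _ _
  ≤-poset = record
    { Carrier = Carrier
    ; _≈_ = _≡_
    ; _≤_ = _≤_
    ; isPartialOrder = record
      { isPreorder = record
        { isEquivalence = isEquivalence ; reflexive = ≤-reflexive ; trans = ≤-trans }
      ; antisym = ≤-antisym } }

  module ≤-Reasoning = PartialOrderReasoning ≤-poset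

  x·y≤x : ∀ x y → x · y ≤ x
  x·y≤x x y = begin
    (x · y) ⇒ x   ≡⟨ cong (_⇒ x) (·-comm x y) ⟩
    (y · x) ⇒ x   ≡⟨ residuation y x x ⟩
    y ⇒ (x ⇒ x)   ≡⟨ cong (y ⇒_) (⇒-refl x) ⟩
    y ⇒ 𝟏         ≡⟨ ⇒-zeroʳ y ⟩
    𝟏             ∎
    where open ≡-Reasoning

  x·y≤y : ∀ x y → x · y ≤ y
  x·y≤y x y = trans (cong (_⇒ y) (·-comm x y)) (x·y≤x y x)

  x·[x⇒y]≤y : ∀ x y → x · (x ⇒ y) ≤ y
  x·[x⇒y]≤y x y = trans (cong (_⇒ y) (·-comm x _)) (uncurry-≤ ≤-refl)

  y≤x⇒y : ∀ x y → y ≤ x ⇒ y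
  y≤x⇒y x y = curry-≤ (x·y≤x y x)

  y≤x⇒[x·y] : ∀ x y → y ≤ x ⇒ (x · y)
  y≤x⇒[x·y] x y = curry-≤ (≤-reflexive (·-comm y x))

  ·-monoʳ-≤ : ∀ x {y z} → y ≤ z → x · y ≤ x · z
  ·-monoʳ-≤ x {y} {z} y≤z = trans (cong (_⇒ (x · z)) (·-comm x y))
    (uncurry-≤ (≤-trans y≤z (y≤x⇒[x·y] x z)))

  ·-monoˡ-≤ : ∀ x {y z} → y ≤ z → y · x ≤ z · x
  ·-monoˡ-≤ x {y} {z} y≤z = subst₂ _≤_ (·-comm x y) (·-comm x z) (·-monoʳ-≤ x y≤z)

  ·-mono-≤ : ∀ {x y z t} → x ≤ y → z ≤ t → x · z ≤ y · t
  ·-mono-≤ {x} {y} {z} {t} x≤y z≤t = ≤-trans (·-monoʳ-≤ x z≤t) (·-monoˡ-≤ t x≤y)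

  ⇒-monoʳ-≤ : ∀ x {y z} → y ≤ z → x ⇒ y ≤ x ⇒ z
  ⇒-monoʳ-≤ x {y} {z} y≤z =
    curry-≤ (≤-trans (trans (cong (_⇒ y) (·-comm _ x)) (x·[x⇒y]≤y x y)) y≤z)

  x≤𝟎⇒x≡𝟎 : ∀ {x} → x ≤ 𝟎 → x ≡ 𝟎
  x≤𝟎⇒x≡𝟎 {x} x≤𝟎 = ≤-antisym x≤𝟎 (𝟎-least x)

  ⊓-greatest : ∀ {t x y} → t ≤ x → t ≤ y → t ≤ x ⊓ y
  ⊓-greatest {t} {x} {y} t≤x t≤y =
    subst (_≤ x ⊓ y) (sym (x≤y⇒x≡y⊓x t≤x)) (·-monoʳ-≤ x (⇒-monoʳ-≤ x t≤y))

  infix 8 ¬_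
  ¬_ : Carrier → Carrier
  ¬ x = x ⇒ 𝟎

  x·¬x≡𝟎 : ∀ x → x · ¬ x ≡ 𝟎
  x·¬x≡𝟎 x = x≤𝟎⇒x≡𝟎 (x·[x⇒y]≤y x 𝟎)

  x≤¬¬x : ∀ x → x ≤ ¬ ¬ x
  x≤¬¬x x = curry-≤ (x·[x⇒y]≤y x 𝟎)

  Idempotent : Carrier → Set
  Idempotent x = x · x ≡ x

  -- With r = ¬ x ⇒ (¬ x · ¬ x), both ¬ x and ¬ x · ¬ x are the meet of r and ¬ x.
  ¬-idempotent : ∀ {x} → Idempotent x → Idempotent (¬ x)
  ¬-idempotent {x} x·x≡x = sym (begin
    ¬ x                        ≡⟨ x≤y⇒x≡y⊓x ¬x≤r ⟩
    r · (r ⇒ ¬ x)              ≡⟨ cong (r ·_) r⇒¬x≡¬x ⟩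
    r · ¬ x                    ≡⟨ ·-comm r (¬ x) ⟩
    ¬ x · r                    ≡⟨ divisibility (¬ x) (¬ x · ¬ x) ⟩
    (¬ x · ¬ x) · ((¬ x · ¬ x) ⇒ ¬ x)
                               ≡⟨ cong ((¬ x · ¬ x) ·_) (x·y≤x (¬ x) (¬ x)) ⟩
    (¬ x · ¬ x) · 𝟏            ≡⟨ ·-identityʳ _ ⟩
    ¬ x · ¬ x                  ∎)
    where
    open ≡-Reasoning
    r = ¬ x ⇒ (¬ x · ¬ x)
    ¬x≤r : ¬ x ≤ r
    ¬x≤r = y≤x⇒[x·y] (¬ x) (¬ x)
    x≤r : x ≤ r
    x≤r = curry-≤ (subst (_≤ ¬ x · ¬ x) (sym (x·¬x≡𝟎 x)) (𝟎-least _))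
    x·r≡x : x · r ≡ x
    x·r≡x = ≤-antisym (x·y≤x x r) (subst (_≤ x · r) x·x≡x (·-monoʳ-≤ x x≤r))
    r⇒¬x≡¬x : r ⇒ ¬ x ≡ ¬ x
    r⇒¬x≡¬x = trans (sym (residuation r x 𝟎)) (cong ¬_ (trans (·-comm r x) x·r≡x))

  x≤y→x≤¬y→x≡𝟎 : ∀ {x y} → Idempotent y → x ≤ y → x ≤ ¬ y → x ≡ 𝟎
  x≤y→x≤¬y→x≡𝟎 {x} {y} y·y≡y x≤y x≤¬y = x≤𝟎⇒x≡𝟎 (begin
    x                 ≤⟨ ⊓-greatest x≤y x≤¬y ⟩
    y ⊓ ¬ y           ≡⟨ cong (y ·_) (trans (sym (residuation y y 𝟎)) (cong ¬_ y·y≡y)) ⟩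
    y · ¬ y           ≡⟨ x·¬x≡𝟎 y ⟩
    𝟎                 ∎)
    where open ≤-Reasoning

  module IdempotentElement {u : Carrier} (u·u≡u : Idempotent u) where

    Fixed : Carrier → Set
    Fixed x = u ⇒ x ≡ x

    u⇒x-fixed : ∀ x → Fixed (u ⇒ x)
    u⇒x-fixed x = trans (sym (residuation u u x)) (cong (_⇒ x) u·u≡u)

    ¬u≤fixed : ∀ {d} → Fixed d → ¬ u ≤ d
    ¬u≤fixed {d} fixed = subst (¬ u ≤_) fixed (⇒-monoʳ-≤ u (𝟎-least d))

    u·[u⇒x]≡u·x : ∀ x → u · (u ⇒ x) ≡ u · x
    u·[u⇒x]≡u·x x = ≤-antisym (begin
      u · (u ⇒ x)          ≡⟨ cong (_· (u ⇒ x)) u·u≡u ⟨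
      (u · u) · (u ⇒ x)    ≡⟨ ·-assoc u u _ ⟩
      u · (u · (u ⇒ x))    ≤⟨ ·-monoʳ-≤ u (x·[x⇒y]≤y u x) ⟩
      u · x                ∎)
      (·-monoʳ-≤ u (y≤x⇒y u x))
      where open ≤-Reasoning

    u⇒-distrib-⇒ : ∀ x y → u ⇒ (x ⇒ y) ≡ (u ⇒ x) ⇒ (u ⇒ y)
    u⇒-distrib-⇒ x y = begin
      u ⇒ (x ⇒ y)          ≡⟨ residuation u x y ⟨
      (u · x) ⇒ y          ≡⟨ cong (_⇒ y) (u·[u⇒x]≡u·x x) ⟨
      (u · (u ⇒ x)) ⇒ y    ≡⟨ cong (_⇒ y) (·-comm u _) ⟩
      ((u ⇒ x) · u) ⇒ y    ≡⟨ residuation _ u y ⟩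
      (u ⇒ x) ⇒ (u ⇒ y)    ∎
      where open ≡-Reasoning

    ⇒-fixed-absorbs : ∀ {r d} → u ≤ r → Fixed d → r ⇒ d ≡ d
    ⇒-fixed-absorbs {r} {d} u≤r fixed = begin
      r ⇒ d                ≡⟨ cong (r ⇒_) fixed ⟨
      r ⇒ (u ⇒ d)          ≡⟨ residuation r u d ⟨
      (r · u) ⇒ d          ≡⟨ cong (_⇒ d) r·u≡u ⟩
      u ⇒ d                ≡⟨ fixed ⟩
      d                    ∎
      where
      open ≡-Reasoning
      r·u≡u : r · u ≡ u
      r·u≡u = ≤-antisym (x·y≤y r u) (subst (_≤ r · u) u·u≡u (·-monoˡ-≤ u u≤r))

    -- With t = u ⇒ (p · q) and r = t ⇒ (p · q), both t and p · q are the meet of t and r.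
    ·-fixed : ∀ {p q} → Fixed p → Fixed q → Fixed (p · q)
    ·-fixed {p} {q} p-fixed q-fixed = begin
      t                    ≡⟨ x≤y⇒x≡y⊓x t≤r ⟩
      r · (r ⇒ t)          ≡⟨ cong (r ·_) (⇒-fixed-absorbs u≤r (u⇒x-fixed (p · q))) ⟩
      r · t                ≡⟨ ·-comm r t ⟩
      t · r                ≡⟨ x≤y⇒x≡y⊓x (y≤x⇒y u (p · q)) ⟨
      p · q                ∎
      where
      open ≡-Reasoning
      t = u ⇒ (p · q)
      r = t ⇒ (p · q)
      u≤r : u ≤ r
      u≤r = curry-≤ (x·[x⇒y]≤y u (p · q))
      t≤r : t ≤ r
      t≤r = curry-≤ (·-mono-≤
        (subst (t ≤_) p-fixed (⇒-monoʳ-≤ u (x·y≤x p q)))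
        (subst (t ≤_) q-fixed (⇒-monoʳ-≤ u (x·y≤y p q))))

    u⇒-distrib-· : ∀ x y → u ⇒ (x · y) ≡ (u ⇒ x) · (u ⇒ y)
    u⇒-distrib-· x y = ≤-antisym
      (subst (u ⇒ (x · y) ≤_) (·-fixed (u⇒x-fixed x) (u⇒x-fixed y))
        (⇒-monoʳ-≤ u (·-mono-≤ (y≤x⇒y u x) (y≤x⇒y u y))))
      (curry-≤ (begin
        ((u ⇒ x) · (u ⇒ y)) · u          ≡⟨ ·-comm _ u ⟩
        u · ((u ⇒ x) · (u ⇒ y))          ≡⟨ cong (_· ((u ⇒ x) · (u ⇒ y))) u·u≡u ⟨
        (u · u) · ((u ⇒ x) · (u ⇒ y))    ≡⟨ interchange u u (u ⇒ x) (u ⇒ y) ⟩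
        (u · (u ⇒ x)) · (u · (u ⇒ y))    ≡⟨ cong₂ _·_ (u·[u⇒x]≡u·x x) (u·[u⇒x]≡u·x y) ⟩
        (u · x) · (u · y)                ≤⟨ ·-mono-≤ (x·y≤y u x) (x·y≤y u y) ⟩
        x · y                            ∎))
      where open ≤-Reasoning

    w : Carrier
    w = ¬ ¬ u

    w·w≡w : Idempotent w
    w·w≡w = ¬-idempotent (¬-idempotent u·u≡u)

    w⇒fixed : ∀ {d} → Fixed d → w ⇒ d ≡ d
    w⇒fixed = ⇒-fixed-absorbs (x≤¬¬x u)

    [x·w]⇒y≡x⇒y : ∀ x {y} → Fixed y → (x · w) ⇒ y ≡ x ⇒ y
    [x·w]⇒y≡x⇒y x {y} y-fixed = trans (residuation x w y) (cong (x ⇒_) (w⇒fixed y-fixed))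

    [x·w]⇒[y·w]≡x⇒y : ∀ x {y} → Fixed y → (x · w) ⇒ (y · w) ≡ x ⇒ y
    [x·w]⇒[y·w]≡x⇒y x {y} y-fixed = trans (residuation x w _) (cong (x ⇒_) w⇒[y·w]≡y)
      where
      w⇒[y·w]≡y : w ⇒ (y · w) ≡ y
      w⇒[y·w]≡y = ≤-antisym
        (subst (w ⇒ (y · w) ≤_) (w⇒fixed y-fixed) (⇒-monoʳ-≤ w (x·y≤x y w)))
        (curry-≤ ≤-refl)

    -- z ≤ d gives z = d ⊓ z = d · (d ⇒ z), and d ⇒ z ≤ w = ¬ ¬ u because its product with ¬ u
    -- lies below both the idempotent ¬ u and ¬ ¬ u, hence is 𝟎.
    [x⇒y]·w≡x⇒[y·w] : ∀ {x y} → Fixed x → Fixed y → (x ⇒ y) · w ≡ x ⇒ (y · w)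
    [x⇒y]·w≡x⇒[y·w] {x} {y} x-fixed y-fixed = ≤-antisym d·w≤z (begin
      z                ≡⟨ x≤y⇒x≡y⊓x (⇒-monoʳ-≤ x (x·y≤x y w)) ⟩
      d · (d ⇒ z)      ≡⟨ cong (d ·_) (residuation d x (y · w)) ⟨
      d · s            ≤⟨ ·-monoʳ-≤ d s≤w ⟩
      d · w            ∎)
      where
      open ≤-Reasoning
      d = x ⇒ y
      z = x ⇒ (y · w)
      s = (d · x) ⇒ (y · w)
      d·w≤z : d · w ≤ z
      d·w≤z = curry-≤ (begin
        (d · w) · x    ≡⟨ xy∙z≈xz∙y d w x ⟩
        (d · x) · w    ≤⟨ ·-monoˡ-≤ w (subst (_≤ y) (·-comm x d) (x·[x⇒y]≤y x y)) ⟩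
        y · w          ∎)
      s·¬u≤w : s · ¬ u ≤ w
      s·¬u≤w = begin
        s · ¬ u        ≤⟨ ·-monoʳ-≤ s (⊓-greatest (¬u≤fixed x-fixed) (¬u≤fixed y-fixed)) ⟩
        s · (x ⊓ y)    ≡⟨ trans (·-comm s _) (cong (_· s) (·-comm x d)) ⟩
        (d · x) · s    ≤⟨ x·[x⇒y]≤y (d · x) (y · w) ⟩
        y · w          ≤⟨ x·y≤y y w ⟩
        w              ∎
      s≤w : s ≤ w
      s≤w = curry-≤ (≤-reflexive
        (x≤y→x≤¬y→x≡𝟎 (¬-idempotent u·u≡u) (x·y≤y s (¬ u)) s·¬u≤w))

    -- The fixed elements form a bounded hoop with least element ¬ u; on them twist is a
    -- homomorphism (fixed elements) × 𝟚 → H sending (¬ u , false) to 𝟎.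
    twist : Bool → Carrier → Carrier
    twist true  x = x
    twist false x = x · w

    twist-· : ∀ p q x y → twist (p ∧ q) (x · y) ≡ twist p x · twist q y
    twist-· true  true  x y = refl
    twist-· true  false x y = ·-assoc x y w
    twist-· false true  x y = xy∙z≈xz∙y x y w
    twist-· false false x y = trans (cong ((x · y) ·_) (sym w·w≡w)) (interchange x y w w)

    twist-⇒ : ∀ p q {x y} → Fixed x → Fixed y →
              twist (p ⇒𝟚 q) (x ⇒ y) ≡ twist p x ⇒ twist q y
    twist-⇒ true  true  _       _       = refl
    twist-⇒ true  false x-fixed y-fixed = [x⇒y]·w≡x⇒[y·w] x-fixed y-fixed
    twist-⇒ false true  _       y-fixed = sym ([x·w]⇒y≡x⇒y _ y-fixed)
    twist-⇒ false false _       y-fixed = sym ([x·w]⇒[y·w]≡x⇒y _ y-fixed)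

    twist-false-¬u : twist false (¬ u) ≡ 𝟎
    twist-false-¬u = x·¬x≡𝟎 (¬ u)

  ∏ : ∀ k → (Fin k → Carrier) → Carrier
  ∏ zero    f = 𝟏
  ∏ (suc k) f = f zero · ∏ k (f ∘ suc)

  ∏-≤ : ∀ k f i → ∏ k f ≤ f i
  ∏-≤ (suc k) f zero    = x·y≤x _ _
  ∏-≤ (suc k) f (suc i) = ≤-trans (x·y≤y _ _) (∏-≤ k (f ∘ suc) i)

  ·-Closed : ∀ {ℓ} → Pred Carrier ℓ → Set ℓ
  ·-Closed P = ∀ {x y} → P x → P y → P (x · y)

  ∏-closed : ∀ {ℓ} (P : Pred Carrier ℓ) → P 𝟏 → ·-Closed P →
             ∀ k f → (∀ i → P (f i)) → P (∏ k f)
  ∏-closed P P𝟏 closed zero    f Pf = P𝟏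
  ∏-closed P P𝟏 closed (suc k) f Pf =
    closed (Pf zero) (∏-closed P P𝟏 closed k (f ∘ suc) (Pf ∘ suc))

  -- The witness is the product of all elements satisfying P.
  least-of-·-closed : ∀ {ℓ} {P : Pred Carrier ℓ} → Finite H → Decidable P → P 𝟏 → ·-Closed P →
                      Σ Carrier λ u → P u × (∀ {x} → P x → u ≤ x)
  least-of-·-closed {P = P} (n , enumeration) P? P𝟏 closed =
    ∏ n (keep ∘ from) , ∏-closed P P𝟏 closed n _ (keep-satisfies ∘ from) , ∏-least
    where
    open Inverse enumeration using (to; from; strictlyInverseʳ)
    keep : Carrier → Carrier
    keep x with P? x
    ... | yes _ = x
    ... | no  _ = 𝟏
    keep-satisfies : ∀ x → P (keep x)
    keep-satisfies x with P? x
    ... | yes Px = Px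
    ... | no  _  = P𝟏
    keep-id : ∀ {x} → P x → keep x ≡ x
    keep-id {x} Px with P? x
    ... | yes _   = refl
    ... | no  ¬Px = contradiction Px ¬Px
    ∏-least : ∀ {x} → P x → ∏ n (keep ∘ from) ≤ x
    ∏-least {x} Px = subst (∏ n (keep ∘ from) ≤_)
      (trans (cong keep (strictlyInverseʳ x)) (keep-id Px)) (∏-≤ n _ (to x))

finite⇒≟ : ∀ {H} → Finite H → DecidableEquality (BoundedHoop.Carrier H)
finite⇒≟ (_ , enumeration) = inj⇒≟ (↔⇒↣ enumeration)

module Lifting {B C : BoundedHoop} (B-finite : Finite B) (C-finite : Finite C)
               {g : BoundedHoop.Carrier B → BoundedHoop.Carrier C} (g-hom : IsHom B C g)
               (g-surjective : Surjective g) where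
  open BoundedHoop B
  open HoopProperties B
  open IsHom g-hom
  private
    module C where
      open BoundedHoop C public
      open HoopProperties C public using (⇒-identityˡ; ·-identityʳ)

  InKernel : Pred Carrier _
  InKernel x = g x ≡ C.𝟏

  kernel-·-closed : ·-Closed InKernel
  kernel-·-closed {x} {y} gx≡𝟏 gy≡𝟏 =
    trans (pres-· x y) (trans (cong₂ C._·_ gx≡𝟏 gy≡𝟏) (C.·-identityˡ C.𝟏))

  private
    least-in-kernel : Σ Carrier λ u → InKernel u × (∀ {x} → InKernel x → u ≤ x)
    least-in-kernel = least-of-·-closed B-finite (λ x → finite⇒≟ {C} C-finite (g x) C.𝟏)
                                        pres-𝟏 kernel-·-closed

  u : Carrier
  u = proj₁ least-in-kernel

  gu≡𝟏 : g u ≡ C.𝟏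
  gu≡𝟏 = proj₁ (proj₂ least-in-kernel)

  u-least : ∀ {x} → g x ≡ C.𝟏 → u ≤ x
  u-least = proj₂ (proj₂ least-in-kernel)

  u·u≡u : Idempotent u
  u·u≡u = ≤-antisym (x·y≤x u u) (u-least (kernel-·-closed gu≡𝟏 gu≡𝟏))

  open IdempotentElement u·u≡u

  g[u⇒x]≡gx : ∀ x → g (u ⇒ x) ≡ g x
  g[u⇒x]≡gx x = begin
    g (u ⇒ x)        ≡⟨ pres-⇒ u x ⟩
    g u C.⇒ g x      ≡⟨ cong (C._⇒ g x) gu≡𝟏 ⟩
    C.𝟏 C.⇒ g x      ≡⟨ C.⇒-identityˡ (g x) ⟩
    g x              ∎
    where open ≡-Reasoning

  gw≡𝟏 : g w ≡ C.𝟏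
  gw≡𝟏 = trans (sym (g[u⇒x]≡gx w)) (trans (cong g (x≤¬¬x u)) pres-𝟏)

  g∘twist≡g : ∀ p x → g (twist p x) ≡ g x
  g∘twist≡g true  x = refl
  g∘twist≡g false x = trans (pres-· x w) (trans (cong (g x C.·_) gw≡𝟏) (C.·-identityʳ (g x)))

  u⇒-respects-g : ∀ {x y} → g x ≡ g y → u ⇒ x ≡ u ⇒ y
  u⇒-respects-g gx≡gy = ≤-antisym (u⇒-mono gx≡gy) (u⇒-mono (sym gx≡gy))
    where
    u⇒-mono : ∀ {x y} → g x ≡ g y → u ⇒ x ≤ u ⇒ y
    u⇒-mono {x} {y} gx≡gy = curry-≤ (begin
      (u ⇒ x) · u      ≡⟨ trans (·-comm _ u) (u·[u⇒x]≡u·x x) ⟩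
      u · x            ≤⟨ uncurry-≤ (u-least g[x⇒y]≡𝟏) ⟩
      y                ∎)
      where
      open ≤-Reasoning
      g[x⇒y]≡𝟏 : g (x ⇒ y) ≡ C.𝟏
      g[x⇒y]≡𝟏 = trans (pres-⇒ x y) (trans (cong (C._⇒ g y) gx≡gy) (C.⇒-refl (g y)))

  preimage : C.Carrier → Carrier
  preimage c = proj₁ (g-surjective c)

  g∘preimage : ∀ c → g (preimage c) ≡ c
  g∘preimage c = proj₂ (g-surjective c)

  -- A section of g that, thanks to u ⇒_, does not depend on the chosen preimages.
  ρ : C.Carrier → Carrier
  ρ c = u ⇒ preimage c

  ρ-fixed : ∀ c → Fixed (ρ c)
  ρ-fixed c = u⇒x-fixed (preimage c)

  g∘ρ : ∀ c → g (ρ c) ≡ c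
  g∘ρ c = trans (g[u⇒x]≡gx (preimage c)) (g∘preimage c)

  ρ-preimage : ∀ {c} x → g x ≡ c → ρ c ≡ u ⇒ x
  ρ-preimage {c} x gx≡c = u⇒-respects-g (trans (g∘preimage c) (sym gx≡c))

  ρ-· : ∀ c d → ρ (c C.· d) ≡ ρ c · ρ d
  ρ-· c d = trans
    (ρ-preimage (preimage c · preimage d)
      (trans (pres-· _ _) (cong₂ C._·_ (g∘preimage c) (g∘preimage d))))
    (u⇒-distrib-· _ _)

  ρ-⇒ : ∀ c d → ρ (c C.⇒ d) ≡ ρ c ⇒ ρ d
  ρ-⇒ c d = trans
    (ρ-preimage (preimage c ⇒ preimage d)
      (trans (pres-⇒ _ _) (cong₂ C._⇒_ (g∘preimage c) (g∘preimage d))))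
    (u⇒-distrib-⇒ _ _)

  ρ-𝟏 : ρ C.𝟏 ≡ 𝟏
  ρ-𝟏 = trans (ρ-preimage 𝟏 pres-𝟏) (⇒-zeroʳ u)

  ρ-𝟎 : ρ C.𝟎 ≡ ¬ u
  ρ-𝟎 = ρ-preimage 𝟎 pres-𝟎

  lift : ∀ {A} → Hom A 𝟚 → (h : Hom A C) →
         Σ (Hom A B) λ f → ∀ a → proj₁ h a ≡ g (proj₁ f a)
  lift {A} (φ , φ-hom) (h , h-hom) = (f , f-hom) , λ a → sym (g∘f a)
    where
    module φ = IsHom φ-hom
    module h = IsHom h-hom
    f : BoundedHoop.Carrier A → Carrier
    f a = twist (φ a) (ρ (h a))
    f-hom : IsHom A B f
    f-hom = record
      { pres-· = λ a b → trans
          (cong₂ twist (φ.pres-· a b) (trans (cong ρ (h.pres-· a b)) (ρ-· _ _)))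
          (twist-· (φ a) (φ b) _ _)
      ; pres-⇒ = λ a b → trans
          (cong₂ twist (φ.pres-⇒ a b) (trans (cong ρ (h.pres-⇒ a b)) (ρ-⇒ _ _)))
          (twist-⇒ (φ a) (φ b) (ρ-fixed (h a)) (ρ-fixed (h b)))
      ; pres-𝟏 = cong₂ twist φ.pres-𝟏 (trans (cong ρ h.pres-𝟏) ρ-𝟏)
      ; pres-𝟎 = trans (cong₂ twist φ.pres-𝟎 (trans (cong ρ h.pres-𝟎) ρ-𝟎)) twist-false-¬u
      }
    g∘f : ∀ a → g (f a) ≡ h a
    g∘f a = trans (g∘twist≡g (φ a) _) (g∘ρ (h a))

𝟙 : BoundedHoop
𝟙 = record
  { Carrier = ⊤ ; _·_ = λ _ _ → tt ; _⇒_ = λ _ _ → tt ; 𝟏 = tt ; 𝟎 = tt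
  ; ·-assoc = λ _ _ _ → refl ; ·-comm = λ _ _ → refl ; ·-identityˡ = λ _ → refl
  ; ⇒-refl = λ _ → refl ; divisibility = λ _ _ → refl ; residuation = λ _ _ _ → refl
  ; 𝟎-least = λ _ → refl
  }

𝟙-finite : Finite 𝟙
𝟙-finite = 1 , mk↔ₛ′ (λ _ → zero) (λ _ → tt) (λ { zero → refl }) (λ _ → refl)

𝟚-finite : Finite 𝟚
𝟚-finite = 2 , mk↔ₛ′ to from
  (λ { zero → refl ; (suc zero) → refl }) (λ { true → refl ; false → refl })
  where
  to : Bool → Fin 2
  to true  = zero
  to false = suc zero
  from : Fin 2 → Bool
  from zero       = true
  from (suc zero) = false

to𝟙 : ∀ A → Hom A 𝟙
to𝟙 A = (λ _ → tt) , record
  { pres-· = λ _ _ → refl ; pres-⇒ = λ _ _ → refl ; pres-𝟏 = refl ; pres-𝟎 = refl }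

finitelyProjective⇒hom𝟚 : ∀ A → FinitelyProjective A → Hom A 𝟚
finitelyProjective⇒hom𝟚 A projective =
  proj₁ (projective 𝟚 𝟙 𝟚-finite 𝟙-finite (to𝟙 A) (to𝟙 𝟚) (λ _ → true , refl))

hom𝟚⇒finitelyProjective : ∀ A → Hom A 𝟚 → FinitelyProjective A
hom𝟚⇒finitelyProjective A φ B C B-finite C-finite h (g , g-hom) g-surjective =
  Lifting.lift B-finite C-finite g-hom g-surjective φ h

mainTheorem6 : (A : BoundedHoop) → Finite A →
    (FinitelyProjective A ⇔ Hom A 𝟚)
mainTheorem6 A _ = mk⇔ (finitelyProjective⇒hom𝟚 A) (hom𝟚⇒finitelyProjective A)
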